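{- Let $\mathbf{k}$ be a commutative ring and $q\in\mathbf{k}$ such that $q+1$ is invertible in $\mathbf{k}$. Then the family $(\eta^{(q)}_{s,I})_{s\ge0,\,I\subseteq[s-1]}$ is a basis of the $\mathbf{k}$-module $\operatorname{QSym}$. Furthermore, for every $s\ge0$ and $J\subseteq[s-1]$, \[(q+1)^{s-|J|}M_J=\sum_{J\subseteq I\subseteq[s-1]}(-1)^{|I\setminus J|}\eta^{(q)}_I.\]
   Context: Let $x_1,x_2,\dots$ be commuting indeterminates. $\operatorname{QSym}$ is the subring of $\mathbf{k}[[x_1,x_2,\dots]]$ of quasisymmetric functions: bounded-degree power series such that for every strictly increasing $i_1<\cdots<i_p$ the coefficient of $x_{i_1}^{k_1}\cdots x_{i_p}^{k_p}$ equals that of $x_1^{k_1}\cdots x_p^{k_p}$. For $s\ge0$ and $I\subseteq[s-1]$ (with $[s-1]=\emptyset$ if $s\le1$), $M_J=M_{s,J}=\sum x_{i_1}\cdots x_{i_s}$ over $i_1\le\cdots\le i_s$ with $j\in J\iff i_j=i_{j+1}$ for all $j\in[s-1]$, and $\eta^{(q)}_I=\eta^{(q)}_{s,I}=\sum(q+1)^{|\{i_1,\dots,i_s\}|}x_{i_1}\cdots x_{i_s}$ over $i_1\le\cdots\le i_s$ with $j\in I\Rightarrow i_j=i_{j+1}$. -}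

module Defs where

open import Level using (Level)
import Algebra.Bundles
open Algebra.Bundles using (CommutativeRing)
open import Data.Nat as ℕ using (ℕ; zero; suc; _≡ᵇ_; _∸_; _≤_; _<_; pred)
open import Data.Bool using (Bool; true; false; _∧_; _∨_; not; if_then_else_)
open import Data.List using (List; []; _∷_; _++_; [_]; replicate; length; map; foldr; upTo)
open import Data.Nat.ListAction using (sum)
open import Data.Vec using (Vec; []; _∷_; toList)
open import Data.Fin.Subset using (Subset; ∣_∣) renaming (_─_ to _∖_)
open import Data.Product using (_×_; _,_; Σ; ∃; ∃-syntax)
open import Relation.Binary.PropositionalEquality using (_≡_)

-- Monomials in x_1, x_2, ... : a monomial x_1^{a_0} x_2^{a_1} ... is an
-- exponent list (a_0 , a_1 , ...) ; position p (0-based) = variable x_{p+1}.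
-- Lists differing by trailing zeros denote the same monomial.
Mono : Set
Mono = List ℕ

-- Sorted index sequence (i_1 ≤ ... ≤ i_s) of a monomial: the unique weakly
-- increasing sequence with x_{i_1} ... x_{i_s} = x^α  (0-based indices).
seqFrom : ℕ → Mono → List ℕ
seqFrom n []       = []
seqFrom n (e ∷ α)  = replicate e n ++ seqFrom (suc n) α

idxSeq : Mono → List ℕ
idxSeq = seqFrom 0

adjEq : List ℕ → List Bool
adjEq (a ∷ b ∷ l) = (a ≡ᵇ b) ∷ adjEq (b ∷ l)
adjEq _           = []

-- number of distinct indices |{i_1,...,i_s}| = number of nonzero exponents
nonzeros : Mono → ℕ
nonzeros []            = 0
nonzeros (zero  ∷ α)   = nonzeros α
nonzeros (suc _ ∷ α)   = suc (nonzeros α)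

impliesAll : List Bool → List Bool → Bool
impliesAll (a ∷ as) (b ∷ bs) = (not a ∨ b) ∧ impliesAll as bs
impliesAll []       []       = true
impliesAll _        _        = false

eqAll : List Bool → List Bool → Bool
eqAll (a ∷ as) (b ∷ bs) = (if a then b else not b) ∧ eqAll as bs
eqAll []       []       = true
eqAll _        _        = false

-- Subsets of [s-1] are Subset (pred s) (= Vec Bool (s-1)); entry j (0-based)
-- stands for element j+1 of [s-1].
subsets : (n : ℕ) → List (Subset n)
subsets zero    = [ [] ]
subsets (suc n) = map (true ∷_) (subsets n) ++ map (false ∷_) (subsets n)

_⊆ᵇ_ : ∀ {n} → Subset n → Subset n → Bool
_⊆ᵇ_ J I = impliesAll (toList J) (toList I)

-- spread ((g₁,k₁) ∷ (g₂,k₂) ∷ ...) is the exponent list of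
-- x_{i_1}^{k_1} x_{i_2}^{k_2} ... where i_1 = g₁+1, i_{j+1} = i_j + 1 + g_{j+1};
-- this parametrizes all strictly increasing i_1 < i_2 < ... < i_p.
spread : List (ℕ × ℕ) → Mono
spread []            = []
spread ((g , k) ∷ l) = replicate g 0 ++ k ∷ spread l

module _ {c ℓ : Level} (R : CommutativeRing c ℓ) where
  open CommutativeRing R
  open import Algebra.Definitions.RawSemiring (Algebra.Bundles.Semiring.rawSemiring semiring) using (_^_)

  Series : Set c
  Series = Mono → Carrier

  Σ[_]_ : {A : Set} → List A → (A → Carrier) → Carrier
  Σ[ xs ] f = foldr (λ x acc → f x + acc) 0# xs

  WellDefined : Series → Set ℓ
  WellDefined f = ∀ α → f α ≈ f (α ++ [ 0 ])

  BoundedDegree : Series → Set ℓ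
  BoundedDegree f = ∃[ d ] (∀ α → d < sum α → f α ≈ 0#)

  Quasisymmetric : Series → Set ℓ
  Quasisymmetric f = ∀ (l : List (ℕ × ℕ)) → f (spread l) ≈ f (map (λ p → Data.Product.proj₂ p) l)

  IsQSym : Series → Set ℓ
  IsQSym f = WellDefined f × BoundedDegree f × Quasisymmetric f

  Mqs : (s : ℕ) → Subset (pred s) → Series
  Mqs s J α =
    if (length (idxSeq α) ≡ᵇ s) ∧ eqAll (toList J) (adjEq (idxSeq α)) then 1# else 0#

  η : Carrier → (s : ℕ) → Subset (pred s) → Series
  η q s I α =
    if (length (idxSeq α) ≡ᵇ s) ∧ impliesAll (toList I) (adjEq (idxSeq α))
    then (1# + q) ^ nonzeros α else 0#

  ηComb : Carrier → (d : ℕ) → ((s : ℕ) → Subset (pred s) → Carrier) → Series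
  ηComb q d cf α = Σ[ upTo (suc d) ] (λ s → Σ[ subsets (pred s) ] (λ I → cf s I * η q s I α))

  IsQSymBasisη : Carrier → Set (c Level.⊔ ℓ)
  IsQSymBasisη q =
    (∀ s (I : Subset (pred s)) → IsQSym (η q s I))
    × (∀ (f : Series) → IsQSym f →
         ∃[ d ] Σ ((s : ℕ) → Subset (pred s) → Carrier) (λ cf → ∀ α → f α ≈ ηComb q d cf α))
    × (∀ (d : ℕ) (cf : (s : ℕ) → Subset (pred s) → Carrier) →
         (∀ α → ηComb q d cf α ≈ 0#) → ∀ s (I : Subset (pred s)) → s ≤ d → cf s I ≈ 0#)

  MηExpansion : Carrier → Set ℓ
  MηExpansion q = ∀ (s : ℕ) (J : Subset (pred s)) (α : Mono) →
    ((1# + q) ^ (s ∸ ∣ J ∣)) * Mqs s J α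
      ≈ Σ[ subsets (pred s) ] (λ I → if J ⊆ᵇ I then ((- 1#) ^ ∣ I ∖ J ∣) * η q s I α else 0#)

-- A monomial x^α of degree s enters M_J and η_I only through its equality pattern E ⊆ [s-1]
-- and its number p = s - |E| of distinct variables: M_J(α) = [J = E] and
-- η_I(α) = (1+q)^p [I ⊆ E].  So in degree s the family η_I is the zeta transform of the
-- Boolean lattice of subsets of [s-1], twisted by the unit (1+q)^p.  Möbius inversion gives
-- the expansion of M_J; invertibility of the zeta transform gives linear independence and,
-- since a quasisymmetric f is determined by its values on the packed monomials
-- x_1^{a_1} ⋯ x_p^{a_p} (one per pattern), spanning.
module Submission where

open import Level using (Level)
open import Algebra.Bundles using (CommutativeRing)
open import Data.Bool using (Bool; true; false; _∧_; if_then_else_)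
open import Data.Bool.Properties using (T-≡; ¬-not)
open import Data.Fin.Subset using (Subset; ∣_∣; _─_)
open import Data.List using (List; []; _∷_; _++_; [_]; replicate; length; map; upTo)
open import Data.List.Properties using (length-++; length-replicate; ++-assoc; ++-identityʳ; upTo-∷ʳ)
open import Data.Nat using (ℕ; zero; suc; _∸_; _≤_; _<_; pred; _≡ᵇ_; s≤s)
open import Data.Nat.ListAction using (sum)
open import Data.Nat.Properties
  using (≡ᵇ⇒≡; ≡⇒≡ᵇ; suc-injective; ≤-refl; ≤-trans; n≤1+n;
         m<n⇒m<1+n; n<1+n; <⇒≢; <-irrefl; m≤n⇒m<n∨m≡n; _≟_; _≤?_; ≰⇒>)
open import Data.Product using (_×_; _,_; Σ; ∃₂; ∃-syntax; proj₁; proj₂)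
open import Data.Sum using (inj₁; inj₂)
open import Data.Vec using ([]; _∷_; toList)
open import Data.Vec.Properties using (length-toList)
open import Function.Base using (_$_)
open import Function.Bundles using (Equivalence)
open import Relation.Binary.PropositionalEquality
  using (_≡_; _≢_; refl; sym; trans; cong; cong₂; subst; module ≡-Reasoning)
open import Relation.Nullary using (yes; no)

open import Defs

module Monomials where
  open import Data.Nat using (_+_)
  open import Data.Nat.Properties using (+-suc; +-assoc; +-identityʳ; m+n∸m≡n)

  ≡ᵇ-true : ∀ {m n} → m ≡ n → (m ≡ᵇ n) ≡ true
  ≡ᵇ-true {m} {n} m≡n = Equivalence.to T-≡ (≡⇒≡ᵇ m n m≡n)

  ≡ᵇ-false : ∀ {m n} → m ≢ n → (m ≡ᵇ n) ≡ false
  ≡ᵇ-false {m} {n} m≢n = ¬-not (λ eq → m≢n (≡ᵇ⇒≡ m n (Equivalence.from T-≡ eq)))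

  eqAll⇒≡ : ∀ xs ys → eqAll xs ys ≡ true → xs ≡ ys
  eqAll⇒≡ []           []           _  = refl
  eqAll⇒≡ (true  ∷ xs) (true  ∷ ys) eq = cong (true ∷_) (eqAll⇒≡ xs ys eq)
  eqAll⇒≡ (false ∷ xs) (false ∷ ys) eq = cong (false ∷_) (eqAll⇒≡ xs ys eq)
  eqAll⇒≡ []           (_ ∷ _)      ()
  eqAll⇒≡ (_ ∷ _)      []           ()
  eqAll⇒≡ (true  ∷ xs) (false ∷ ys) ()
  eqAll⇒≡ (false ∷ xs) (true  ∷ ys) ()

  replicate-++-∷ : ∀ {A : Set} k (x : A) xs → replicate k x ++ x ∷ xs ≡ x ∷ replicate k x ++ xs
  replicate-++-∷ zero    x xs = refl
  replicate-++-∷ (suc k) x xs = cong (x ∷_) (replicate-++-∷ k x xs)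

  toList-onto : ∀ {A : Set} n (xs : List A) → length xs ≡ n → ∃[ v ] toList {n = n} v ≡ xs
  toList-onto zero    []       _  = [] , refl
  toList-onto (suc n) (x ∷ xs) eq = let v , v≡xs = toList-onto n xs (suc-injective eq) in
                                    x ∷ v , cong (x ∷_) v≡xs

  countTrue : List Bool → ℕ
  countTrue []          = 0
  countTrue (true  ∷ bs) = suc (countTrue bs)
  countTrue (false ∷ bs) = countTrue bs

  countTrue-replicate : ∀ k bs → countTrue (replicate k true ++ bs) ≡ k + countTrue bs
  countTrue-replicate zero    bs = refl
  countTrue-replicate (suc k) bs = cong suc (countTrue-replicate k bs)

  ∣∣≡countTrue : ∀ {n} (J : Subset n) → ∣ J ∣ ≡ countTrue (toList J)
  ∣∣≡countTrue []          = refl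
  ∣∣≡countTrue (true  ∷ J) = cong suc (∣∣≡countTrue J)
  ∣∣≡countTrue (false ∷ J) = ∣∣≡countTrue J

  degree : Mono → ℕ
  degree α = length (idxSeq α)

  -- the J ⊆ [degree α - 1] for which x^α is a monomial of M_J
  eqPattern : Mono → List Bool
  eqPattern α = adjEq (idxSeq α)

  flatten : Mono → List ℕ
  flatten []          = []
  flatten (zero  ∷ α) = flatten α
  flatten (suc a ∷ α) = suc a ∷ flatten α

  -- the composition whose equality pattern is E, except that its first part is k larger
  runs : ℕ → List Bool → Mono
  runs k []          = [ suc k ]
  runs k (true  ∷ E) = runs (suc k) E
  runs k (false ∷ E) = suc k ∷ runs 0 E

  -- the monomial x_1^{a_1} ⋯ x_p^{a_p} of M_{s,E} using only the first variables
  fromPattern : ℕ → List Bool → Mono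
  fromPattern zero    _ = []
  fromPattern (suc _) E = runs 0 E

  length-seqFrom : ∀ m α → length (seqFrom m α) ≡ sum α
  length-seqFrom m []      = refl
  length-seqFrom m (e ∷ α) = begin
    length (replicate e m ++ seqFrom (suc m) α)        ≡⟨ length-++ (replicate e m) ⟩
    length (replicate e m) + length (seqFrom (suc m) α) ≡⟨ cong₂ _+_ (length-replicate e) (length-seqFrom (suc m) α) ⟩
    e + sum α                                           ∎
    where open ≡-Reasoning

  degree≡sum : ∀ α → degree α ≡ sum α
  degree≡sum = length-seqFrom 0

  length-adjEq : ∀ xs → length (adjEq xs) ≡ pred (length xs)
  length-adjEq []           = refl
  length-adjEq (x ∷ [])     = refl
  length-adjEq (x ∷ y ∷ xs) = cong suc (length-adjEq (y ∷ xs))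

  adjEq-replicate : ∀ k m xs → adjEq (replicate (suc k) m ++ xs) ≡ replicate k true ++ adjEq (m ∷ xs)
  adjEq-replicate zero    m xs = refl
  adjEq-replicate (suc k) m xs = cong₂ _∷_ (≡ᵇ-true {m} refl) (adjEq-replicate k m xs)

  countTrue-adjEq-gap : ∀ n m α → n < m → countTrue (adjEq (n ∷ seqFrom m α)) ≡ countTrue (adjEq (seqFrom m α))
  countTrue-adjEq-gap n m []          n<m = refl
  countTrue-adjEq-gap n m (zero  ∷ α) n<m = countTrue-adjEq-gap n (suc m) α (m<n⇒m<1+n n<m)
  countTrue-adjEq-gap n m (suc a ∷ α) n<m rewrite ≡ᵇ-false (<⇒≢ n<m) = refl

  countTrue-adjEq-seqFrom : ∀ m α → countTrue (adjEq (seqFrom m α)) + nonzeros α ≡ sum α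
  countTrue-adjEq-seqFrom m []          = refl
  countTrue-adjEq-seqFrom m (zero  ∷ α) = countTrue-adjEq-seqFrom (suc m) α
  countTrue-adjEq-seqFrom m (suc a ∷ α) = begin
    countTrue (adjEq (replicate (suc a) m ++ X)) + suc (nonzeros α)
      ≡⟨ cong (λ bs → countTrue bs + suc (nonzeros α)) (adjEq-replicate a m X) ⟩
    countTrue (replicate a true ++ adjEq (m ∷ X)) + suc (nonzeros α)
      ≡⟨ cong (_+ suc (nonzeros α)) (countTrue-replicate a (adjEq (m ∷ X))) ⟩
    a + countTrue (adjEq (m ∷ X)) + suc (nonzeros α)
      ≡⟨ cong (λ t → a + t + suc (nonzeros α)) (countTrue-adjEq-gap m (suc m) α ≤-refl) ⟩
    a + countTrue (adjEq X) + suc (nonzeros α)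
      ≡⟨ +-suc (a + countTrue (adjEq X)) (nonzeros α) ⟩
    suc (a + countTrue (adjEq X) + nonzeros α)
      ≡⟨ cong suc (+-assoc a (countTrue (adjEq X)) (nonzeros α)) ⟩
    suc (a + (countTrue (adjEq X) + nonzeros α))
      ≡⟨ cong (λ t → suc (a + t)) (countTrue-adjEq-seqFrom (suc m) α) ⟩
    suc (a + sum α) ∎
    where
    open ≡-Reasoning
    X = seqFrom (suc m) α

  degree∸card≡nonzeros : ∀ {s} (J : Subset (pred s)) α → degree α ≡ s → toList J ≡ eqPattern α →
    s ∸ ∣ J ∣ ≡ nonzeros α
  degree∸card≡nonzeros J α refl J≡E = begin
    degree α ∸ ∣ J ∣
      ≡⟨ cong (degree α ∸_) (trans (∣∣≡countTrue J) (cong countTrue J≡E)) ⟩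
    degree α ∸ t
      ≡⟨ cong (_∸ t) (trans (degree≡sum α) (sym (countTrue-adjEq-seqFrom 0 α))) ⟩
    t + nonzeros α ∸ t
      ≡⟨ m+n∸m≡n t (nonzeros α) ⟩
    nonzeros α ∎
    where
    open ≡-Reasoning
    t = countTrue (eqPattern α)

  runs-replicate : ∀ k e E → runs k (replicate e true ++ E) ≡ runs (k + e) E
  runs-replicate k zero    E rewrite +-identityʳ k = refl
  runs-replicate k (suc e) E rewrite +-suc k e = runs-replicate (suc k) e E

  runs-adjEq-block : ∀ k a m α →
    runs k (adjEq (replicate (suc a) m ++ seqFrom (suc m) α)) ≡ suc (k + a) ∷ flatten α
  runs-adjEq-gap : ∀ k n m α → n < m → runs k (adjEq (n ∷ seqFrom m α)) ≡ suc k ∷ flatten α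

  runs-adjEq-block k a m α = begin
    runs k (adjEq (replicate (suc a) m ++ X))   ≡⟨ cong (runs k) (adjEq-replicate a m X) ⟩
    runs k (replicate a true ++ adjEq (m ∷ X))  ≡⟨ runs-replicate k a (adjEq (m ∷ X)) ⟩
    runs (k + a) (adjEq (m ∷ X))                ≡⟨ runs-adjEq-gap (k + a) m (suc m) α ≤-refl ⟩
    suc (k + a) ∷ flatten α                     ∎
    where
    open ≡-Reasoning
    X = seqFrom (suc m) α

  runs-adjEq-gap k n m []          n<m = refl
  runs-adjEq-gap k n m (zero  ∷ α) n<m = runs-adjEq-gap k n (suc m) α (m<n⇒m<1+n n<m)
  runs-adjEq-gap k n m (suc a ∷ α) n<m rewrite ≡ᵇ-false (<⇒≢ n<m) =
    cong (suc k ∷_) (runs-adjEq-block 0 a m α)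

  fromPattern-eqPattern : ∀ α → fromPattern (degree α) (eqPattern α) ≡ flatten α
  fromPattern-eqPattern = go 0
    where
    go : ∀ m α → fromPattern (length (seqFrom m α)) (adjEq (seqFrom m α)) ≡ flatten α
    go m []          = refl
    go m (zero  ∷ α) = go (suc m) α
    go m (suc a ∷ α) = runs-adjEq-block 0 a m α

  adjEq-∷-runs : ∀ m k E → adjEq (m ∷ seqFrom (suc m) (runs k E)) ≡ false ∷ adjEq (seqFrom (suc m) (runs k E))
  adjEq-∷-runs m k []          rewrite ≡ᵇ-false (<⇒≢ (n<1+n m)) = refl
  adjEq-∷-runs m k (true  ∷ E) = adjEq-∷-runs m (suc k) E
  adjEq-∷-runs m k (false ∷ E) rewrite ≡ᵇ-false (<⇒≢ (n<1+n m)) = refl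

  adjEq-runs : ∀ m k E → adjEq (seqFrom m (runs k E)) ≡ replicate k true ++ E
  adjEq-runs m k []          = adjEq-replicate k m []
  adjEq-runs m k (true  ∷ E) = trans (adjEq-runs m (suc k) E) (sym (replicate-++-∷ k true E))
  adjEq-runs m k (false ∷ E) = begin
    adjEq (replicate (suc k) m ++ X)              ≡⟨ adjEq-replicate k m X ⟩
    replicate k true ++ adjEq (m ∷ X)             ≡⟨ cong (replicate k true ++_) (adjEq-∷-runs m 0 E) ⟩
    replicate k true ++ false ∷ adjEq X           ≡⟨ cong (λ bs → replicate k true ++ false ∷ bs) (adjEq-runs (suc m) 0 E) ⟩
    replicate k true ++ false ∷ E                 ∎
    where
    open ≡-Reasoning
    X = seqFrom (suc m) (runs 0 E)

  sum-runs : ∀ k E → sum (runs k E) ≡ suc (k + length E)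
  sum-runs k []          = refl
  sum-runs k (true  ∷ E) = trans (sum-runs (suc k) E) (cong suc (sym (+-suc k (length E))))
  sum-runs k (false ∷ E) = cong (λ n → suc (k + n)) (sum-runs 0 E)

  degree-fromPattern : ∀ s E → length E ≡ pred s → degree (fromPattern s E) ≡ s
  degree-fromPattern zero    E _     = refl
  degree-fromPattern (suc n) E len≡n =
    trans (degree≡sum (runs 0 E)) (trans (sum-runs 0 E) (cong suc len≡n))

  eqPattern-fromPattern : ∀ s E → length E ≡ pred s → eqPattern (fromPattern s E) ≡ E
  eqPattern-fromPattern zero    []      _ = refl
  eqPattern-fromPattern zero    (_ ∷ _) ()
  eqPattern-fromPattern (suc n) E       _ = adjEq-runs 0 0 E

  sum-flatten : ∀ α → sum (flatten α) ≡ sum α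
  sum-flatten []          = refl
  sum-flatten (zero  ∷ α) = sum-flatten α
  sum-flatten (suc a ∷ α) = cong (suc a +_) (sum-flatten α)

  nonzeros-flatten : ∀ α → nonzeros (flatten α) ≡ nonzeros α
  nonzeros-flatten []          = refl
  nonzeros-flatten (zero  ∷ α) = nonzeros-flatten α
  nonzeros-flatten (suc a ∷ α) = cong suc (nonzeros-flatten α)

  degree-flatten : ∀ α → degree (flatten α) ≡ degree α
  degree-flatten α = trans (degree≡sum (flatten α)) (trans (sum-flatten α) (sym (degree≡sum α)))

  eqPattern-flatten : ∀ α → eqPattern (flatten α) ≡ eqPattern α
  eqPattern-flatten α = begin
    eqPattern (flatten α)                             ≡⟨ cong eqPattern (sym (fromPattern-eqPattern α)) ⟩
    eqPattern (fromPattern (degree α) (eqPattern α))  ≡⟨ eqPattern-fromPattern (degree α) (eqPattern α) (length-adjEq (idxSeq α)) ⟩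
    eqPattern α                                       ∎
    where open ≡-Reasoning

  flatten-∷ʳ-0 : ∀ α → flatten (α ++ [ 0 ]) ≡ flatten α
  flatten-∷ʳ-0 []          = refl
  flatten-∷ʳ-0 (zero  ∷ α) = flatten-∷ʳ-0 α
  flatten-∷ʳ-0 (suc a ∷ α) = cong (suc a ∷_) (flatten-∷ʳ-0 α)

  flatten-replicate-0 : ∀ g α → flatten (replicate g 0 ++ α) ≡ flatten α
  flatten-replicate-0 zero    α = refl
  flatten-replicate-0 (suc g) α = flatten-replicate-0 g α

  flatten-spread : ∀ l → flatten (spread l) ≡ flatten (map proj₂ l)
  flatten-spread []            = refl
  flatten-spread ((g , k) ∷ l) = trans (flatten-replicate-0 g (k ∷ spread l)) (head k)
    where
    head : ∀ k → flatten (k ∷ spread l) ≡ flatten (k ∷ map proj₂ l)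
    head zero    = flatten-spread l
    head (suc k) = cong (suc k ∷_) (flatten-spread l)

  spread-decomposition : ∀ g α → ∃₂ λ l t →
    replicate g 0 ++ α ≡ spread l ++ replicate t 0 × map proj₂ l ≡ flatten α
  spread-decomposition g []          = [] , g , ++-identityʳ (replicate g 0) , refl
  spread-decomposition g (zero  ∷ α) =
    let l , t , α≡ , m≡ = spread-decomposition (suc g) α in
    l , t , trans (replicate-++-∷ g 0 α) α≡ , m≡
  spread-decomposition g (suc a ∷ α) =
    let l , t , α≡ , m≡ = spread-decomposition 0 α in
    (g , suc a) ∷ l , t ,
    trans (cong (λ β → replicate g 0 ++ suc a ∷ β) α≡) (sym (++-assoc (replicate g 0) (suc a ∷ spread l) _)) ,
    cong (suc a ∷_) m≡

open Monomials

module _ {c ℓ : Level} (R : CommutativeRing c ℓ) where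
  open CommutativeRing R renaming (refl to ≈-refl; sym to ≈-sym; trans to ≈-trans)
  open import Algebra.Properties.CommutativeSemiring.Exp commutativeSemiring using (_^_; ^-congʳ)
  open import Algebra.Properties.Ring ring using (-1*x≈-x)
  open import Algebra.Properties.CommutativeSemigroup *-commutativeSemigroup using (interchange)
  open import Relation.Binary.Reasoning.Setoid setoid

  ∑ : {A : Set} → List A → (A → Carrier) → Carrier
  ∑ = Σ[_]_ R

  ∑-++ : ∀ {A : Set} (xs ys : List A) f → ∑ (xs ++ ys) f ≈ ∑ xs f + ∑ ys f
  ∑-++ []       ys f = ≈-sym (+-identityˡ _)
  ∑-++ (x ∷ xs) ys f = ≈-trans (+-congˡ (∑-++ xs ys f)) (≈-sym (+-assoc _ _ _))

  ∑-map : ∀ {A B : Set} (g : A → B) xs f → ∑ (map g xs) f ≡ ∑ xs (λ x → f (g x))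
  ∑-map g []       f = refl
  ∑-map g (x ∷ xs) f = cong (f (g x) +_) (∑-map g xs f)

  ∑-cong : ∀ {A : Set} (xs : List A) {f g : A → Carrier} → (∀ x → f x ≈ g x) → ∑ xs f ≈ ∑ xs g
  ∑-cong []       f≈g = ≈-refl
  ∑-cong (x ∷ xs) f≈g = +-cong (f≈g x) (∑-cong xs f≈g)

  ∑-zero : ∀ {A : Set} (xs : List A) {f : A → Carrier} → (∀ x → f x ≈ 0#) → ∑ xs f ≈ 0#
  ∑-zero []       f≈0 = ≈-refl
  ∑-zero (x ∷ xs) f≈0 = ≈-trans (+-cong (f≈0 x) (∑-zero xs f≈0)) (+-identityʳ 0#)

  ∑-*ˡ : ∀ {A : Set} (xs : List A) f k → k * ∑ xs f ≈ ∑ xs (λ x → k * f x)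
  ∑-*ˡ []       f k = zeroʳ k
  ∑-*ˡ (x ∷ xs) f k = ≈-trans (distribˡ k _ _) (+-congˡ (∑-*ˡ xs f k))

  ∑-*ʳ : ∀ {A : Set} (xs : List A) f k → ∑ xs f * k ≈ ∑ xs (λ x → f x * k)
  ∑-*ʳ []       f k = zeroˡ k
  ∑-*ʳ (x ∷ xs) f k = ≈-trans (distribʳ k _ _) (+-congˡ (∑-*ʳ xs f k))

  ∑-subsets-suc : ∀ n (f : Subset (suc n) → Carrier) →
    ∑ (subsets (suc n)) f ≈ ∑ (subsets n) (λ I → f (true ∷ I)) + ∑ (subsets n) (λ I → f (false ∷ I))
  ∑-subsets-suc n f = ≈-trans (∑-++ (map (true ∷_) (subsets n)) _ f)
    (+-cong (reflexive (∑-map _ (subsets n) f)) (reflexive (∑-map _ (subsets n) f)))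

  ∑-subsets-split : ∀ n {f : Subset (suc n) → Carrier} {x y} →
    ∑ (subsets n) (λ I → f (true ∷ I)) ≈ x → ∑ (subsets n) (λ I → f (false ∷ I)) ≈ y →
    ∑ (subsets (suc n)) f ≈ x + y
  ∑-subsets-split n ∑₁≈x ∑₀≈y = ≈-trans (∑-subsets-suc n _) (+-cong ∑₁≈x ∑₀≈y)

  ∑-upTo-suc : ∀ (F : ℕ → Carrier) d → ∑ (upTo (suc d)) F ≈ ∑ (upTo d) F + F d
  ∑-upTo-suc F d = begin
    ∑ (upTo (suc d)) F          ≡⟨ cong (λ xs → ∑ xs F) (sym (upTo-∷ʳ d)) ⟩
    ∑ (upTo d ++ [ d ]) F       ≈⟨ ∑-++ (upTo d) [ d ] F ⟩
    ∑ (upTo d) F + (F d + 0#)   ≈⟨ +-congˡ (+-identityʳ (F d)) ⟩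
    ∑ (upTo d) F + F d          ∎

  ∑-upTo-vanish : ∀ {F : ℕ → Carrier} s₀ → (∀ s → s ≢ s₀ → F s ≈ 0#) →
    ∀ d → d ≤ s₀ → ∑ (upTo d) F ≈ 0#
  ∑-upTo-vanish s₀ F≈0 zero    _     = ≈-refl
  ∑-upTo-vanish {F} s₀ F≈0 (suc d) d<s₀ = begin
    ∑ (upTo (suc d)) F   ≈⟨ ∑-upTo-suc F d ⟩
    ∑ (upTo d) F + F d
      ≈⟨ +-cong (∑-upTo-vanish s₀ F≈0 d (≤-trans (n≤1+n d) d<s₀)) (F≈0 d (λ d≡s₀ → <-irrefl d≡s₀ d<s₀)) ⟩
    0# + 0#              ≈⟨ +-identityʳ 0# ⟩
    0#                   ∎

  ∑-upTo-single : ∀ {F : ℕ → Carrier} s₀ → (∀ s → s ≢ s₀ → F s ≈ 0#) →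
    ∀ d → s₀ < d → ∑ (upTo d) F ≈ F s₀
  ∑-upTo-single {F} s₀ F≈0 (suc d) (s≤s s₀≤d) with m≤n⇒m<n∨m≡n s₀≤d
  ... | inj₁ s₀<d = begin
    ∑ (upTo (suc d)) F   ≈⟨ ∑-upTo-suc F d ⟩
    ∑ (upTo d) F + F d
      ≈⟨ +-cong (∑-upTo-single s₀ F≈0 d s₀<d) (F≈0 d (λ d≡s₀ → <-irrefl (sym d≡s₀) s₀<d)) ⟩
    F s₀ + 0#            ≈⟨ +-identityʳ (F s₀) ⟩
    F s₀                 ∎
  ... | inj₂ refl = begin
    ∑ (upTo (suc s₀)) F   ≈⟨ ∑-upTo-suc F s₀ ⟩
    ∑ (upTo s₀) F + F s₀  ≈⟨ +-congʳ (∑-upTo-vanish s₀ F≈0 s₀ ≤-refl) ⟩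
    0# + F s₀             ≈⟨ +-identityˡ (F s₀) ⟩
    F s₀                  ∎

  if-0# : ∀ b {x} → x ≈ 0# → (if b then x else 0#) ≈ 0#
  if-0# true  x≈0 = x≈0
  if-0# false x≈0 = ≈-refl

  if-0#-cong : ∀ b {x y} → x ≈ y → (if b then x else 0#) ≈ (if b then y else 0#)
  if-0#-cong true  x≈y = x≈y
  if-0#-cong false x≈y = ≈-refl

  *-if-0# : ∀ b x y → x * (if b then y else 0#) ≈ (if b then x else 0#) * y
  *-if-0# true  x y = ≈-refl
  *-if-0# false x y = ≈-trans (zeroʳ x) (≈-sym (zeroˡ y))

  ^-inverse : ∀ {x u} → x * u ≈ 1# → ∀ m → u ^ m * x ^ m ≈ 1#
  ^-inverse x*u≈1 zero    = *-identityˡ 1#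
  ^-inverse {x} {u} x*u≈1 (suc m) = begin
    u * u ^ m * (x * x ^ m)   ≈⟨ interchange u (u ^ m) x (x ^ m) ⟩
    u * x * (u ^ m * x ^ m)   ≈⟨ *-cong (≈-trans (*-comm u x) x*u≈1) (^-inverse x*u≈1 m) ⟩
    1# * 1#                   ≈⟨ *-identityˡ 1# ⟩
    1#                        ∎

  ^-cancel : ∀ {x u y} → x * u ≈ 1# → ∀ m → y * x ^ m ≈ 0# → y ≈ 0#
  ^-cancel {x} {u} {y} x*u≈1 m yxᵐ≈0 = begin
    y                        ≈⟨ ≈-sym (*-identityʳ y) ⟩
    y * 1#                   ≈⟨ *-congˡ (≈-sym (≈-trans (*-comm _ _) (^-inverse x*u≈1 m))) ⟩
    y * (x ^ m * u ^ m)      ≈⟨ ≈-sym (*-assoc y _ _) ⟩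
    y * x ^ m * u ^ m        ≈⟨ *-congʳ yxᵐ≈0 ⟩
    0# * u ^ m               ≈⟨ zeroˡ _ ⟩
    0#                       ∎

  ζ : ∀ {n} → (Subset n → Carrier) → Subset n → Carrier
  ζ {n} f K = ∑ (subsets n) (λ I → if I ⊆ᵇ K then f I else 0#)

  ζ-true : ∀ {n} (f : Subset (suc n) → Carrier) K →
    ζ f (true ∷ K) ≈ ζ (λ I → f (true ∷ I)) K + ζ (λ I → f (false ∷ I)) K
  ζ-true {n} f K = ∑-subsets-suc n _

  ζ-false : ∀ {n} (f : Subset (suc n) → Carrier) K → ζ f (false ∷ K) ≈ ζ (λ I → f (false ∷ I)) K
  ζ-false {n} f K = ≈-trans (∑-subsets-split n (∑-zero (subsets n) (λ _ → ≈-refl)) ≈-refl) (+-identityˡ _)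

  ζ-vanish : ∀ {n} {f : Subset n → Carrier} → (∀ I → f I ≈ 0#) → ∀ K → ζ f K ≈ 0#
  ζ-vanish {n} f≈0 K = ∑-zero (subsets n) (λ I → if-0# (I ⊆ᵇ K) (f≈0 I))

  ζ-surjective : ∀ n (g : Subset n → Carrier) → ∃[ f ] ∀ K → ζ f K ≈ g K
  ζ-surjective zero    g = (λ _ → g []) , λ { [] → +-identityʳ _ }
  ζ-surjective (suc n) g = f , ζf≈g
    where
    g₁ g₀ : Subset n → Carrier
    g₁ K = g (true ∷ K) - g (false ∷ K)
    g₀ K = g (false ∷ K)
    f₁ = proj₁ (ζ-surjective n g₁)
    f₀ = proj₁ (ζ-surjective n g₀)
    f : Subset (suc n) → Carrier
    f (true  ∷ I) = f₁ I
    f (false ∷ I) = f₀ I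
    ζf≈g : ∀ K → ζ f K ≈ g K
    ζf≈g (true ∷ K) = begin
      ζ f (true ∷ K)                    ≈⟨ ζ-true f K ⟩
      ζ f₁ K + ζ f₀ K                   ≈⟨ +-cong (proj₂ (ζ-surjective n g₁) K) (proj₂ (ζ-surjective n g₀) K) ⟩
      g (true ∷ K) - g₀ K + g₀ K        ≈⟨ +-assoc _ _ _ ⟩
      g (true ∷ K) + (- g₀ K + g₀ K)    ≈⟨ +-congˡ (-‿inverseˡ _) ⟩
      g (true ∷ K) + 0#                 ≈⟨ +-identityʳ _ ⟩
      g (true ∷ K)                      ∎
    ζf≈g (false ∷ K) = ≈-trans (ζ-false f K) (proj₂ (ζ-surjective n g₀) K)

  ζ-injective : ∀ {n} (f : Subset n → Carrier) → (∀ K → ζ f K ≈ 0#) → ∀ I → f I ≈ 0#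
  ζ-injective {zero}  f ζf≈0 [] = ≈-trans (≈-sym (+-identityʳ _)) (ζf≈0 [])
  ζ-injective {suc n} f ζf≈0 = f≈0
    where
    f₀≈0 : ∀ I → f (false ∷ I) ≈ 0#
    f₀≈0 = ζ-injective _ (λ K → ≈-trans (≈-sym (ζ-false f K)) (ζf≈0 (false ∷ K)))
    f₁≈0 : ∀ I → f (true ∷ I) ≈ 0#
    f₁≈0 = ζ-injective _ λ K → begin
      ζ (λ I → f (true ∷ I)) K                ≈⟨ ≈-sym (+-identityʳ _) ⟩
      ζ (λ I → f (true ∷ I)) K + 0#           ≈⟨ +-congˡ (≈-sym (ζ-vanish f₀≈0 K)) ⟩
      ζ (λ I → f (true ∷ I)) K + ζ (λ I → f (false ∷ I)) K ≈⟨ ≈-sym (ζ-true f K) ⟩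
      ζ f (true ∷ K)                          ≈⟨ ζf≈0 (true ∷ K) ⟩
      0#                                      ∎
    f≈0 : ∀ I → f I ≈ 0#
    f≈0 (true  ∷ I) = f₁≈0 I
    f≈0 (false ∷ I) = f₀≈0 I

  möbius : ∀ n (J : Subset n) (E : List Bool) (k : Carrier) →
    ∑ (subsets n) (λ I → if J ⊆ᵇ I then ((- 1#) ^ ∣ I ─ J ∣) * (if impliesAll (toList I) E then k else 0#) else 0#)
      ≈ (if eqAll (toList J) E then k else 0#)
  möbius zero    []      []      k = ≈-trans (+-identityʳ _) (*-identityˡ k)
  möbius zero    []      (_ ∷ _) k = ≈-trans (+-identityʳ _) (*-identityˡ 0#)
  möbius (suc n) (_ ∷ J) []      k =
    ∑-zero (subsets (suc n)) λ { (_ ∷ I) → if-0# _ (zeroʳ _) }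
  möbius (suc n) (true ∷ J) (true ∷ E) k =
    ≈-trans (∑-subsets-split n (möbius n J E k) (∑-zero (subsets n) (λ _ → ≈-refl))) (+-identityʳ _)
  möbius (suc n) (true ∷ J) (false ∷ E) k = ≈-trans
    (∑-subsets-split n (∑-zero (subsets n) (λ I → if-0# (J ⊆ᵇ I) (zeroʳ _))) (∑-zero (subsets n) (λ _ → ≈-refl)))
    (+-identityʳ 0#)
  möbius (suc n) (false ∷ J) (false ∷ E) k =
    ≈-trans (∑-subsets-split n (∑-zero (subsets n) (λ I → if-0# (J ⊆ᵇ I) (zeroʳ _))) (möbius n J E k)) (+-identityˡ _)
  -- toggling the new element of I flips the sign of the term and changes nothing else
  möbius (suc n) (false ∷ J) (true ∷ E) k = begin
    _                  ≈⟨ ∑-subsets-suc n _ ⟩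
    ∑ (subsets n) (λ I → if J ⊆ᵇ I then (- 1# * (- 1#) ^ ∣ I ─ J ∣) * term I else 0#) + S
                       ≈⟨ +-congʳ (∑-cong (subsets n) (λ I → if-*-assoc (J ⊆ᵇ I) _ (term I))) ⟩
    ∑ (subsets n) (λ I → - 1# * (if J ⊆ᵇ I then (- 1#) ^ ∣ I ─ J ∣ * term I else 0#)) + S
                       ≈⟨ +-congʳ (≈-sym (∑-*ˡ (subsets n) _ (- 1#))) ⟩
    - 1# * S + S       ≈⟨ +-congʳ (-1*x≈-x S) ⟩
    - S + S            ≈⟨ -‿inverseˡ S ⟩
    0#                 ∎
    where
    term : Subset n → Carrier
    term I = if impliesAll (toList I) E then k else 0#
    S = ∑ (subsets n) (λ I → if J ⊆ᵇ I then ((- 1#) ^ ∣ I ─ J ∣) * term I else 0#)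
    if-*-assoc : ∀ b x y → (if b then (- 1# * x) * y else 0#) ≈ - 1# * (if b then x * y else 0#)
    if-*-assoc true  x y = *-assoc _ x y
    if-*-assoc false x y = ≈-sym (zeroʳ _)

  wellDefined-replicate : ∀ {f} → WellDefined R f → ∀ t α → f (α ++ replicate t 0) ≈ f α
  wellDefined-replicate {f} wd zero    α = reflexive (cong f (++-identityʳ α))
  wellDefined-replicate {f} wd (suc t) α = begin
    f (α ++ 0 ∷ replicate t 0)     ≡⟨ cong f (sym (++-assoc α [ 0 ] (replicate t 0))) ⟩
    f ((α ++ [ 0 ]) ++ replicate t 0) ≈⟨ wellDefined-replicate wd t (α ++ [ 0 ]) ⟩
    f (α ++ [ 0 ])                 ≈⟨ ≈-sym (wd α) ⟩
    f α                            ∎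

  isQSym-flatten : ∀ {f} → IsQSym R f → ∀ α → f α ≈ f (flatten α)
  isQSym-flatten {f} (wd , _ , qs) α =
    let l , t , α≡ , m≡ = spread-decomposition 0 α in begin
    f α                            ≡⟨ cong f α≡ ⟩
    f (spread l ++ replicate t 0)  ≈⟨ wellDefined-replicate wd t (spread l) ⟩
    f (spread l)                   ≈⟨ qs l ⟩
    f (map proj₂ l)                ≡⟨ cong f m≡ ⟩
    f (flatten α)                  ∎

  flatten-invariant⇒wellDefined : ∀ {f} → (∀ α → f α ≡ f (flatten α)) → WellDefined R f
  flatten-invariant⇒wellDefined {f} inv α = begin
    f α                      ≡⟨ inv α ⟩
    f (flatten α)            ≡⟨ cong f (sym (flatten-∷ʳ-0 α)) ⟩
    f (flatten (α ++ [ 0 ])) ≡⟨ sym (inv (α ++ [ 0 ])) ⟩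
    f (α ++ [ 0 ])           ∎

  flatten-invariant⇒quasisymmetric : ∀ {f} → (∀ α → f α ≡ f (flatten α)) → Quasisymmetric R f
  flatten-invariant⇒quasisymmetric {f} inv l = begin
    f (spread l)                ≡⟨ inv (spread l) ⟩
    f (flatten (spread l))      ≡⟨ cong f (flatten-spread l) ⟩
    f (flatten (map proj₂ l))   ≡⟨ sym (inv (map proj₂ l)) ⟩
    f (map proj₂ l)             ∎

  Coefficients : Set c
  Coefficients = (s : ℕ) → Subset (pred s) → Carrier

  module _ (q : Carrier) where

    η-off-degree : ∀ s I α → degree α ≢ s → η R q s I α ≈ 0#
    η-off-degree s I α deg≢s = reflexive $
      cong (λ b → if b ∧ impliesAll (toList I) (eqPattern α) then (1# + q) ^ nonzeros α else 0#) (≡ᵇ-false deg≢s)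

    η-on-degree : ∀ s I α → degree α ≡ s →
      η R q s I α ≈ (if impliesAll (toList I) (eqPattern α) then (1# + q) ^ nonzeros α else 0#)
    η-on-degree s I α deg≡s = reflexive $
      cong (λ b → if b ∧ impliesAll (toList I) (eqPattern α) then (1# + q) ^ nonzeros α else 0#) (≡ᵇ-true deg≡s)

    η-flatten : ∀ s I α → η R q s I α ≡ η R q s I (flatten α)
    η-flatten s I α rewrite degree-flatten α | eqPattern-flatten α | nonzeros-flatten α = refl

    η-isQSym : ∀ s I → IsQSym R (η R q s I)
    η-isQSym s I =
      flatten-invariant⇒wellDefined (η-flatten s I) ,
      (s , λ α s<sum → η-off-degree s I α (λ deg≡s → <⇒≢ s<sum (trans (sym deg≡s) (degree≡sum α)))) ,
      flatten-invariant⇒quasisymmetric (η-flatten s I)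

    layer : Coefficients → Mono → ℕ → Carrier
    layer cf α s = ∑ (subsets (pred s)) (λ I → cf s I * η R q s I α)

    layer-off-degree : ∀ cf α s → degree α ≢ s → layer cf α s ≈ 0#
    layer-off-degree cf α s deg≢s =
      ∑-zero (subsets (pred s)) (λ I → ≈-trans (*-congˡ (η-off-degree s I α deg≢s)) (zeroʳ _))

    ηComb-vanishes : ∀ d cf α → d < degree α → ηComb R q d cf α ≈ 0#
    ηComb-vanishes d cf α d<deg =
      ∑-upTo-vanish (degree α) (λ s s≢deg → layer-off-degree cf α s (λ deg≡s → s≢deg (sym deg≡s))) (suc d) d<deg

    ηComb-coefficient : ∀ d cf s (K : Subset (pred s)) α → degree α ≡ s → toList K ≡ eqPattern α → s ≤ d →
      ηComb R q d cf α ≈ ζ (cf s) K * (1# + q) ^ nonzeros α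
    ηComb-coefficient d cf s K α deg≡s K≡E s≤d = begin
      ηComb R q d cf α
        ≈⟨ ∑-upTo-single s (λ s′ s′≢s → layer-off-degree cf α s′ (λ deg≡s′ → s′≢s (trans (sym deg≡s′) deg≡s)))
                         (suc d) (s≤s s≤d) ⟩
      ∑ (subsets (pred s)) (λ I → cf s I * η R q s I α)
        ≈⟨ ∑-cong (subsets (pred s)) (λ I → *-congˡ (η-on-pattern I)) ⟩
      ∑ (subsets (pred s)) (λ I → cf s I * (if I ⊆ᵇ K then (1# + q) ^ nonzeros α else 0#))
        ≈⟨ ∑-cong (subsets (pred s)) (λ I → *-if-0# (I ⊆ᵇ K) (cf s I) _) ⟩
      ∑ (subsets (pred s)) (λ I → (if I ⊆ᵇ K then cf s I else 0#) * (1# + q) ^ nonzeros α)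
        ≈⟨ ≈-sym (∑-*ʳ (subsets (pred s)) _ _) ⟩
      ζ (cf s) K * (1# + q) ^ nonzeros α ∎
      where
      η-on-pattern : ∀ I → η R q s I α ≈ (if I ⊆ᵇ K then (1# + q) ^ nonzeros α else 0#)
      η-on-pattern I = ≈-trans (η-on-degree s I α deg≡s)
        (reflexive (cong (λ E → if impliesAll (toList I) E then (1# + q) ^ nonzeros α else 0#) (sym K≡E)))

    Mqs-off-degree : ∀ s J α → degree α ≢ s → Mqs R s J α ≡ 0#
    Mqs-off-degree s J α deg≢s = cong (λ b → if b ∧ eqAll (toList J) (eqPattern α) then 1# else 0#) (≡ᵇ-false deg≢s)

    Mqs-on-degree : ∀ s J α → degree α ≡ s → Mqs R s J α ≡ (if eqAll (toList J) (eqPattern α) then 1# else 0#)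
    Mqs-on-degree s J α deg≡s = cong (λ b → if b ∧ eqAll (toList J) (eqPattern α) then 1# else 0#) (≡ᵇ-true deg≡s)

    Mη-expansion : MηExpansion R q
    Mη-expansion s J α with degree α ≟ s
    ... | no deg≢s = begin
      (1# + q) ^ (s ∸ ∣ J ∣) * Mqs R s J α   ≡⟨ cong ((1# + q) ^ (s ∸ ∣ J ∣) *_) (Mqs-off-degree s J α deg≢s) ⟩
      (1# + q) ^ (s ∸ ∣ J ∣) * 0#            ≈⟨ zeroʳ _ ⟩
      0#                                      ≈⟨ ≈-sym (∑-zero (subsets (pred s)) (λ I → if-0# (J ⊆ᵇ I) (term≈0 I))) ⟩
      _                                       ∎
      where
      term≈0 : ∀ I → (- 1#) ^ ∣ I ─ J ∣ * η R q s I α ≈ 0#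
      term≈0 I = ≈-trans (*-congˡ (η-off-degree s I α deg≢s)) (zeroʳ _)
    ... | yes deg≡s = begin
      (1# + q) ^ (s ∸ ∣ J ∣) * Mqs R s J α
        ≡⟨ cong ((1# + q) ^ (s ∸ ∣ J ∣) *_) (Mqs-on-degree s J α deg≡s) ⟩
      (1# + q) ^ (s ∸ ∣ J ∣) * (if eqAll (toList J) E then 1# else 0#)
        ≈⟨ exponent-on-pattern ⟩
      (if eqAll (toList J) E then (1# + q) ^ nonzeros α else 0#)
        ≈⟨ ≈-sym (möbius (pred s) J E _) ⟩
      ∑ (subsets (pred s)) (λ I → if J ⊆ᵇ I
                                    then ((- 1#) ^ ∣ I ─ J ∣) * (if impliesAll (toList I) E then (1# + q) ^ nonzeros α else 0#)
                                    else 0#)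
        ≈⟨ ∑-cong (subsets (pred s)) (λ I → if-0#-cong (J ⊆ᵇ I) (*-congˡ (≈-sym (η-on-degree s I α deg≡s)))) ⟩
      ∑ (subsets (pred s)) (λ I → if J ⊆ᵇ I then ((- 1#) ^ ∣ I ─ J ∣) * η R q s I α else 0#) ∎
      where
      E = eqPattern α
      exponent-on-pattern : (1# + q) ^ (s ∸ ∣ J ∣) * (if eqAll (toList J) E then 1# else 0#)
                ≈ (if eqAll (toList J) E then (1# + q) ^ nonzeros α else 0#)
      exponent-on-pattern with eqAll (toList J) E in J≐E
      ... | true  = ≈-trans (*-identityʳ _) (^-congʳ (1# + q) (degree∸card≡nonzeros J α deg≡s (eqAll⇒≡ (toList J) E J≐E)))
      ... | false = zeroʳ _

    module _ (u : Carrier) (unit : (1# + q) * u ≈ 1#) where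

      η-spanning : ∀ f → IsQSym R f →
        ∃[ d ] Σ Coefficients (λ cf → ∀ α → f α ≈ ηComb R q d cf α)
      η-spanning f isQSym@(_ , (d , bounded) , _) = d , cf , f≈ηComb
        where
        -- the coefficient of f at the packed monomial with pattern K, divided by (1+q)^(number of parts)
        target : Coefficients
        target s K = f (fromPattern s (toList K)) * u ^ nonzeros (fromPattern s (toList K))
        cf : Coefficients
        cf s = proj₁ (ζ-surjective (pred s) (target s))
        f≈ηComb : ∀ α → f α ≈ ηComb R q d cf α
        f≈ηComb α with degree α ≤? d
        ... | no deg≰d = ≈-trans (bounded α (subst (d <_) (degree≡sum α) (≰⇒> deg≰d)))
                                 (≈-sym (ηComb-vanishes d cf α (≰⇒> deg≰d)))
        ... | yes deg≤d with toList-onto (pred (degree α)) (eqPattern α) (length-adjEq (idxSeq α))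
        ... | K , K≡E = ≈-sym $ begin
          ηComb R q d cf α                              ≈⟨ ηComb-coefficient d cf s K α refl K≡E deg≤d ⟩
          ζ (cf s) K * (1# + q) ^ m                     ≈⟨ *-congʳ (proj₂ (ζ-surjective (pred s) (target s)) K) ⟩
          f β * u ^ nonzeros β * (1# + q) ^ m           ≡⟨ cong (λ γ → f γ * u ^ nonzeros γ * (1# + q) ^ m) β≡flat ⟩
          f (flatten α) * u ^ nonzeros (flatten α) * (1# + q) ^ m
                                                        ≡⟨ cong (λ n → f (flatten α) * u ^ n * (1# + q) ^ m) (nonzeros-flatten α) ⟩
          f (flatten α) * u ^ m * (1# + q) ^ m          ≈⟨ *-assoc _ _ _ ⟩
          f (flatten α) * (u ^ m * (1# + q) ^ m)        ≈⟨ *-congˡ (^-inverse unit m) ⟩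
          f (flatten α) * 1#                            ≈⟨ *-identityʳ _ ⟩
          f (flatten α)                                 ≈⟨ ≈-sym (isQSym-flatten isQSym α) ⟩
          f α                                           ∎
          where
          s = degree α
          m = nonzeros α
          β = fromPattern s (toList K)
          β≡flat : β ≡ flatten α
          β≡flat = trans (cong (fromPattern s) K≡E) (fromPattern-eqPattern α)

      η-independent : ∀ d cf → (∀ α → ηComb R q d cf α ≈ 0#) → ∀ s (I : Subset (pred s)) → s ≤ d → cf s I ≈ 0#
      η-independent d cf ηComb≈0 s I s≤d = ζ-injective (cf s) ζ≈0 I
        where
        ζ≈0 : ∀ K → ζ (cf s) K ≈ 0#
        ζ≈0 K = ^-cancel unit (nonzeros β) (begin
          ζ (cf s) K * (1# + q) ^ nonzeros β   ≈⟨ ≈-sym (ηComb-coefficient d cf s K β deg≡s K≡E s≤d) ⟩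
          ηComb R q d cf β                      ≈⟨ ηComb≈0 β ⟩
          0#                                    ∎)
          where
          β = fromPattern s (toList K)
          deg≡s = degree-fromPattern s (toList K) (length-toList K)
          K≡E = sym (eqPattern-fromPattern s (toList K) (length-toList K))

theorem3p7 : ∀ {c ℓ} (R : CommutativeRing c ℓ) (q : CommutativeRing.Carrier R) →
    (∃[ u ] CommutativeRing._≈_ R (CommutativeRing._*_ R (CommutativeRing._+_ R (CommutativeRing.1# R) q) u) (CommutativeRing.1# R)) →
    IsQSymBasisη R q × MηExpansion R q
theorem3p7 R q (u , unit) =
  (η-isQSym R q , η-spanning R q u unit , η-independent R q u unit) , Mη-expansion R q
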